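{- Let $k,j\in\mathbb N^+$ and $\alpha,\beta\in(0,\frac12)$. Let $T$ be a balanced rooted antidirected tree with $k$ edges such that $\Delta(T)\le(\frac{\alpha\beta k}{8})^{\frac1{j+1}}$, and let $(W,\mathcal T)$ be a $\beta$-decomposition of (the underlying tree of) $T$. Set $p_T:=|V_{\mathrm{in}}(T)\setminus L_j(T)|$ and $q_T:=|V_{\mathrm{out}}(T)\setminus L_j(T)|$. Then $(1-\alpha)p_T\le q_T\le(1+\alpha)p_T$.
   Context: An antidirected tree is an orientation of a tree with no directed path of 2 edges. $V_{\mathrm{in}}(T)$ is the set of vertices of $T$ with no outgoing edges and $V_{\mathrm{out}}(T)$ the set of vertices with no incoming edges; $T$ is balanced if $|V_{\mathrm{in}}(T)|=|V_{\mathrm{out}}(T)|$. $\Delta(T)$ is the maximum degree of the underlying tree. For $\beta\in(0,1)$ and a tree $T$ on $k+1$ vertices rooted at $r$, a $\beta$-decomposition is a pair $(W,\mathcal T)$ with $W\subseteq V(T)$ and $\mathcal T$ a family of rooted trees such that: $r\in W$; $\mathcal T$ consists of the components of $T-W$, each $S\in\mathcal T$ rooted at its vertex closest to $r$; $|S|\le\beta k$ for each $S\in\mathcal T$; and $|W|\le\frac1\beta+2$. For $S\in\mathcal T$, $Lev_j(S)$ is the union of the first $j$ levels of the rooted tree $S$ (the root forming the first level), and $L_j(T)=\bigcup_{S\in\mathcal T}Lev_j(S)$.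
   Formalization: The parameters α and β are rational numbers in the interval (0,½). -}

module Defs where

open import Data.Nat as ℕ using (ℕ; zero; suc; _^_)
open import Data.Fin using (Fin; _≟_)
open import Data.Fin.Subset using (Subset; _∈_; _∉_; ∣_∣)
open import Data.Vec using (tabulate)
open import Data.Bool using (Bool; true; false)
open import Data.List using (List; []; length; filter; null)
open import Data.List.Membership.Propositional using () renaming (_∈_ to _∈ₗ_)
open import Data.Product using (_×_; _,_; ∃; ∃-syntax; proj₁; proj₂)
open import Data.Sum using (_⊎_)
open import Data.Unit using (⊤)
open import Data.Empty using (⊥)
open import Data.Integer using (+_)
open import Data.Rational using (ℚ; _/_)
open import Relation.Nullary using (¬_)
open import Relation.Nullary.Decidable using (_⊎-dec_)
open import Function.Bundles using (_⇔_)

⟦_⟧ : ℕ → ℚ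
⟦ n ⟧ = + n / 1

-- An oriented graph on the vertex set Fin n is given by its list of arcs (u , v) = u → v.
Arcs : ℕ → Set
Arcs n = List (Fin n × Fin n)

module _ {n : ℕ} (A : Arcs n) where

  Arc : Fin n → Fin n → Set
  Arc u v = (u , v) ∈ₗ A

  Adj : Fin n → Fin n → Set
  Adj u v = Arc u v ⊎ Arc v u

  data Walk (P : Fin n → Set) : Fin n → Fin n → ℕ → Set where
    here : ∀ {u} → P u → Walk P u u 0
    step : ∀ {u v w ℓ} → P u → Adj u v → Walk P v w ℓ → Walk P u w (suc ℓ)

  Dist : (P : Fin n → Set) → Fin n → Fin n → ℕ → Set
  Dist P u v d = Walk P u v d × (∀ d' → Walk P u v d' → d ℕ.≤ d')

  AllV : Fin n → Set
  AllV _ = ⊤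

  Connected : Set
  Connected = ∀ u v → ∃[ ℓ ] Walk AllV u v ℓ

  IsTree : Set
  IsTree = Connected × suc (length A) ≡ₙ n
    where
    open import Relation.Binary.PropositionalEquality using () renaming (_≡_ to _≡ₙ_)

  IsAntidirected : Set
  IsAntidirected = ∀ u v w → Arc u v → Arc v w → ⊥

  deg : Fin n → ℕ
  deg v = length (filter (λ e → (proj₁ e ≟ v) ⊎-dec (proj₂ e ≟ v)) A)

  -- V_in : vertices with no outgoing arcs; V_out : vertices with no incoming arcs
  Vin : Subset n
  Vin = tabulate (λ v → null (filter (λ e → proj₁ e ≟ v) A))

  Vout : Subset n
  Vout = tabulate (λ v → null (filter (λ e → proj₂ e ≟ v) A))

  IsBalanced : Set
  IsBalanced = ∣ Vin ∣ ≡ₙ ∣ Vout ∣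
    where
    open import Relation.Binary.PropositionalEquality using () renaming (_≡_ to _≡ₙ_)

  module _ (W : Subset n) where

    SameComp : Fin n → Fin n → Set
    SameComp v u = ∃[ ℓ ] Walk (λ x → x ∉ W) v u ℓ

    IsCompRoot : Fin n → Fin n → Fin n → Set
    IsCompRoot r v ρ =
      SameComp v ρ ×
      (∀ u → SameComp v u → ∀ dρ du → Dist AllV r ρ dρ → Dist AllV r u du → dρ ℕ.≤ du)

    -- v ∈ L_j(T) : v belongs to the first j levels of its component S (root = level 1),
    -- i.e. its distance in S from the root of S is less than j
    InL : Fin n → ℕ → Fin n → Set
    InL r j v = v ∉ W × ∃[ ρ ] (IsCompRoot r v ρ × ∃[ d ] (d ℕ.< j × Dist (SameComp v) ρ v d))

    -- (W , 𝒯) is a β-decomposition of the tree rooted at r with k edges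
    -- (𝒯 is determined by W: it is the set of components of T - W)
    IsDecomposition : ℕ → Fin n → ℚ → Set
    IsDecomposition k r β =
      r ∈ W ×
      (∀ v → v ∉ W → (S : Subset n) → (∀ u → (u ∈ S) ⇔ SameComp v u) →
         ⟦ ∣ S ∣ ⟧ Data.Rational.≤ β Data.Rational.* ⟦ k ⟧) ×
      -- |W| ≤ 1/β + 2, written multiplied out by β > 0
      (⟦ ∣ W ∣ ⟧ Data.Rational.* β Data.Rational.≤ Data.Rational.1ℚ Data.Rational.+ ⟦ 2 ⟧ Data.Rational.* β)

module Submission where

-- Every vertex of L_j(T) lies within distance j of W: the root of its component S of T − W is
-- the vertex of S closest to r ∈ W, so a shortest walk from r enters S at its root, which is
-- therefore adjacent to W. A tree on three or more vertices has Δ ≥ 2, so a ball of radius j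
-- has fewer than Δ^(j+1) vertices and |L_j(T)| ≤ M := |W| Δ^(j+1) ≤ αk/4 by the bounds on Δ
-- and |W|. As T is antidirected and balanced, |V_in| = |V_out| ≥ (k+1)/2, and p_T, q_T both
-- lie within M of this common value; since k + 1 ≤ 2(p_T + M), M ≤ α p_T, which gives both
-- inequalities.

open import Defs
open import Data.Nat using (ℕ; zero; suc; _^_)
open import Data.Fin using (Fin)
open import Data.Fin.Subset using (Subset; _∈_; _∉_; ∣_∣)
open import Data.Product using (_×_)
open import Relation.Nullary using (¬_)
open import Data.Rational using (ℚ; 0ℚ; 1ℚ; ½; _<_; _≤_; _*_; _+_; _-_)
open import Function.Bundles using (_⇔_)

import Data.Nat as ℕ
import Data.Nat.Properties as ℕ
open import Data.Bool using (true; false)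
open import Data.Empty using (⊥-elim)
open import Data.Fin as Fin using (_≟_)
open import Data.Fin.Properties using (any?)
open import Data.Fin.Subset using (inside; outside; ⊥; ⊤; _∪_; ⁅_⁆)
open import Data.Fin.Subset.Properties using (_∈?_; p⊆q⇒∣p∣≤∣q∣; x∈p∪q⁺; x∈⁅x⁆; ∣⁅x⁆∣≡1; ∣⊥∣≡0; ∣⊤∣≡n)
open import Data.Integer as ℤ using (+_)
import Data.Integer.Properties as ℤ
open import Data.List using (List; []; _∷_; length; map; filter; null; concatMap; allFin)
open import Data.List.Extrema.Nat using (argmax; f[xs]≤f[argmax])
open import Data.List.Membership.Propositional using () renaming (_∈_ to _∈ₗ_)
open import Data.List.Membership.Propositional.Properties using (∈-filter⁺; ∈-filter⁻; ∈-map⁺; ∈-concat⁺′; ∈-allFin)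
open import Data.List.Properties using (length-map; length-++)
import Data.List.Relation.Unary.All as All
open import Data.List.Relation.Unary.Any using (here; there)
open import Data.Product using (_,_; ∃-syntax; proj₁; proj₂)
open import Data.Product.Properties using (≡-dec)
open import Data.Rational using (NonNegative; toℚᵘ; -_; nonNegative)
open import Data.Rational.Properties
  using (toℚᵘ-injective; toℚᵘ-fromℚᵘ; toℚᵘ-homo-+; toℚᵘ-homo-*; normalize-nonNeg; nonNegative⁻¹;
         +-monoˡ-≤; +-monoʳ-≤; *-monoˡ-≤-nonNeg; *-monoʳ-≤-nonNeg; *-cancelʳ-≤-pos; nonNeg*nonNeg⇒nonNeg;
         ≤-trans; <⇒≤; ≤-<-trans; <-irrefl; _<?_; +-identityʳ; *-assoc; *-comm; *-identityˡ; module ≤-Reasoning)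
open import Data.Rational.Solver using (module +-*-Solver)
import Data.Rational.Unnormalised as ℚᵘ
import Data.Rational.Unnormalised.Properties as ℚᵘ
open import Data.Sum using (_⊎_; inj₁; inj₂; map₂)
open import Data.Unit using (tt)
open import Data.Vec using ([]; _∷_; here; there)
open import Data.Vec.Properties using (lookup∘tabulate; lookup⇒[]=)
open import Function.Base using (_∘′_)
open import Function.Bundles using (module Equivalence)
open import Relation.Nullary using (Dec; yes; no)
open import Relation.Nullary.Decidable using (_⊎-dec_; _×-dec_; map′; toWitness)
open import Relation.Unary using (Decidable)
open import Relation.Binary.PropositionalEquality using (_≡_; refl; sym; trans; cong; cong₂; subst; subst₂)

open +-*-Solver using (solve; _:=_; con; _:+_; _:*_; _:-_)

elements : ∀ {n} → Subset n → List (Fin n)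
elements []            = []
elements (inside ∷ p)  = Fin.zero ∷ map Fin.suc (elements p)
elements (outside ∷ p) = map Fin.suc (elements p)

length-elements : ∀ {n} (p : Subset n) → length (elements p) ≡ ∣ p ∣
length-elements []            = refl
length-elements (inside ∷ p)  = cong suc (trans (length-map Fin.suc (elements p)) (length-elements p))
length-elements (outside ∷ p) = trans (length-map Fin.suc (elements p)) (length-elements p)

∈-elements : ∀ {n} {p : Subset n} {x} → x ∈ p → x ∈ₗ elements p
∈-elements {p = inside ∷ p}  here      = here refl
∈-elements {p = inside ∷ p}  (there x) = there (∈-map⁺ Fin.suc (∈-elements x))
∈-elements {p = outside ∷ p} (there x) = ∈-map⁺ Fin.suc (∈-elements x)

∣p∪q∣≤∣p∣+∣q∣ : ∀ {n} (p q : Subset n) → ∣ p ∪ q ∣ ℕ.≤ ∣ p ∣ ℕ.+ ∣ q ∣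
∣p∪q∣≤∣p∣+∣q∣ []            []            = ℕ.z≤n
∣p∪q∣≤∣p∣+∣q∣ (inside ∷ p)  (inside ∷ q)  =
  ℕ.s≤s (ℕ.≤-trans (∣p∪q∣≤∣p∣+∣q∣ p q) (ℕ.+-monoʳ-≤ ∣ p ∣ (ℕ.n≤1+n ∣ q ∣)))
∣p∪q∣≤∣p∣+∣q∣ (inside ∷ p)  (outside ∷ q) = ℕ.s≤s (∣p∪q∣≤∣p∣+∣q∣ p q)
∣p∪q∣≤∣p∣+∣q∣ (outside ∷ p) (inside ∷ q)  =
  subst (suc ∣ p ∪ q ∣ ℕ.≤_) (sym (ℕ.+-suc ∣ p ∣ ∣ q ∣)) (ℕ.s≤s (∣p∪q∣≤∣p∣+∣q∣ p q))
∣p∪q∣≤∣p∣+∣q∣ (outside ∷ p) (outside ∷ q) = ∣p∪q∣≤∣p∣+∣q∣ p q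

∣p∣≤∣q∣+length : ∀ {n} {p q : Subset n} (xs : List (Fin n)) →
  (∀ {x} → x ∈ p → x ∈ q ⊎ x ∈ₗ xs) → ∣ p ∣ ℕ.≤ ∣ q ∣ ℕ.+ length xs
∣p∣≤∣q∣+length {n} {p} {q} xs p⊆q∪xs = begin
  ∣ p ∣                     ≤⟨ p⊆q⇒∣p∣≤∣q∣ (λ x∈p → x∈p∪q⁺ (map₂ ∈-fromList (p⊆q∪xs x∈p))) ⟩
  ∣ q ∪ fromList xs ∣       ≤⟨ ∣p∪q∣≤∣p∣+∣q∣ q (fromList xs) ⟩
  ∣ q ∣ ℕ.+ ∣ fromList xs ∣ ≤⟨ ℕ.+-monoʳ-≤ ∣ q ∣ (∣fromList∣≤length xs) ⟩
  ∣ q ∣ ℕ.+ length xs       ∎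
  where
  open ℕ.≤-Reasoning
  fromList : List (Fin n) → Subset n
  fromList []       = ⊥
  fromList (x ∷ xs) = ⁅ x ⁆ ∪ fromList xs

  ∈-fromList : ∀ {x xs} → x ∈ₗ xs → x ∈ fromList xs
  ∈-fromList (here refl) = x∈p∪q⁺ (inj₁ (x∈⁅x⁆ _))
  ∈-fromList (there x∈xs) = x∈p∪q⁺ (inj₂ (∈-fromList x∈xs))

  ∣fromList∣≤length : ∀ xs → ∣ fromList xs ∣ ℕ.≤ length xs
  ∣fromList∣≤length []       = ℕ.≤-reflexive (∣⊥∣≡0 n)
  ∣fromList∣≤length (x ∷ xs) = begin
    ∣ ⁅ x ⁆ ∪ fromList xs ∣       ≤⟨ ∣p∪q∣≤∣p∣+∣q∣ ⁅ x ⁆ (fromList xs) ⟩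
    ∣ ⁅ x ⁆ ∣ ℕ.+ ∣ fromList xs ∣ ≡⟨ cong (ℕ._+ ∣ fromList xs ∣) (∣⁅x⁆∣≡1 x) ⟩
    suc ∣ fromList xs ∣           ≤⟨ ℕ.s≤s (∣fromList∣≤length xs) ⟩
    length (x ∷ xs)               ∎

∣p∣≤∣p∖X∣+length : ∀ {n} {X : Fin n → Set} {p q : Subset n} (xs : List (Fin n)) →
  (∀ {x} → X x → x ∈ₗ xs) → (∀ x → x ∈ q ⇔ (x ∈ p × ¬ X x)) → ∣ p ∣ ℕ.≤ ∣ q ∣ ℕ.+ length xs
∣p∣≤∣p∖X∣+length {X = X} {p} {q} xs X⊆xs q≡p∖X = ∣p∣≤∣q∣+length xs in-q-or-xs
  where
  open import Data.List.Membership.DecPropositional _≟_ using () renaming (_∈?_ to _∈?ₗ_)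
  in-q-or-xs : ∀ {x} → x ∈ p → x ∈ q ⊎ x ∈ₗ xs
  in-q-or-xs {x} x∈p with x ∈?ₗ xs
  ... | yes x∈xs = inj₂ x∈xs
  ... | no x∉xs  = inj₁ (Equivalence.from (q≡p∖X x) (x∈p , λ Xx → x∉xs (X⊆xs Xx)))

length-concatMap-≤ : ∀ {A B : Set} (f : A → List B) {s} → (∀ x → length (f x) ℕ.≤ s) →
  ∀ xs → length (concatMap f xs) ℕ.≤ length xs ℕ.* s
length-concatMap-≤ f f≤s []       = ℕ.z≤n
length-concatMap-≤ f f≤s (x ∷ xs) rewrite length-++ (f x) {concatMap f xs} =
  ℕ.+-mono-≤ (f≤s x) (length-concatMap-≤ f f≤s xs)

∃-filter : ∀ {A : Set} {Q : A → Set} (Q? : Decidable Q) {xs} → null (filter Q? xs) ≡ false → ∃[ x ] (x ∈ₗ xs × Q x)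
∃-filter Q? {xs} nonnull with filter Q? xs in eq
... | x ∷ _ = x , ∈-filter⁻ Q? (subst (x ∈ₗ_) (sym eq) (here refl))

module _ {P : ℕ → Set} (P? : Decidable P) where

  Minimal : Set
  Minimal = ∃[ m ] (P m × ∀ {m′} → P m′ → m ℕ.≤ m′)

  private
    search : ∀ b k → (∀ {m} → m ℕ.< b → ¬ P m) → P (k ℕ.+ b) → Minimal
    search b k below pk with P? b
    ... | yes pb = b , pb , λ pm → ℕ.≮⇒≥ (λ m<b → below m<b pm)
    search b zero    below pb | no ¬pb = ⊥-elim (¬pb pb)
    search b (suc k) below pk | no ¬pb = search (suc b) k below′ (subst P (sym (ℕ.+-suc k b)) pk)
      where
      below′ : ∀ {m} → m ℕ.< suc b → ¬ P m
      below′ m<1+b with ℕ.m<1+n⇒m<n∨m≡n m<1+b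
      ... | inj₁ m<b  = below m<b
      ... | inj₂ refl = ¬pb

  minimal : ∀ {l} → P l → Minimal
  minimal {l} pl = search 0 l (λ ()) (subst P (sym (ℕ.+-identityʳ l)) pl)

geomSum : ℕ → ℕ → ℕ
geomSum D zero    = 1
geomSum D (suc m) = suc (D ℕ.* geomSum D m)

geomSum<^ : ∀ {D} → 2 ℕ.≤ D → ∀ m → geomSum D m ℕ.< D ^ suc m
geomSum<^ {D} 2≤D zero    = ℕ.≤-trans 2≤D (ℕ.≤-reflexive (sym (ℕ.*-identityʳ D)))
geomSum<^ {D} 2≤D (suc m) = begin
  suc (suc (D ℕ.* geomSum D m))  ≤⟨ ℕ.+-monoˡ-≤ (D ℕ.* geomSum D m) 2≤D ⟩
  D ℕ.+ D ℕ.* geomSum D m        ≡⟨ ℕ.*-suc D (geomSum D m) ⟨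
  D ℕ.* suc (geomSum D m)        ≤⟨ ℕ.*-monoʳ-≤ D (geomSum<^ 2≤D m) ⟩
  D ℕ.* D ^ suc m                ∎
  where open ℕ.≤-Reasoning

module _ {n : ℕ} (A : Arcs n) where

  opposite : Fin n → Fin n × Fin n → Fin n
  opposite v (a , b) with a ≟ v
  ... | yes _ = b
  ... | no _  = a

  neighbours : Fin n → List (Fin n)
  neighbours v = map (opposite v) (filter (λ e → (proj₁ e ≟ v) ⊎-dec (proj₂ e ≟ v)) A)

  length-neighbours : ∀ v → length (neighbours v) ≡ deg A v
  length-neighbours v = length-map (opposite v) (filter (λ e → (proj₁ e ≟ v) ⊎-dec (proj₂ e ≟ v)) A)

  adj⇒∈neighbours : ∀ {u y} → Adj A u y → y ∈ₗ neighbours u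
  adj⇒∈neighbours {u} {y} (inj₁ u→y) = subst (_∈ₗ neighbours u) (opposite-tail u y)
    (∈-map⁺ (opposite u) (∈-filter⁺ (λ e → (proj₁ e ≟ u) ⊎-dec (proj₂ e ≟ u)) u→y (inj₁ refl)))
    where
    opposite-tail : ∀ u y → opposite u (u , y) ≡ y
    opposite-tail u y with u ≟ u
    ... | yes _  = refl
    ... | no u≢u = ⊥-elim (u≢u refl)
  adj⇒∈neighbours {u} {y} (inj₂ y→u) = subst (_∈ₗ neighbours u) (opposite-head u y)
    (∈-map⁺ (opposite u) (∈-filter⁺ (λ e → (proj₁ e ≟ u) ⊎-dec (proj₂ e ≟ u)) y→u (inj₂ refl)))
    where
    opposite-head : ∀ u y → opposite u (y , u) ≡ y
    opposite-head u y with y ≟ u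
    ... | yes y≡u = sym y≡u
    ... | no _    = refl

  adj⇒1≤deg : ∀ {u y} → Adj A u y → 1 ℕ.≤ deg A u
  adj⇒1≤deg {u} u~y = subst (1 ℕ.≤_) (length-neighbours u) (nonempty (adj⇒∈neighbours u~y))
    where
    nonempty : ∀ {xs : List (Fin n)} {x} → x ∈ₗ xs → 1 ℕ.≤ length xs
    nonempty (here _)  = ℕ.s≤s ℕ.z≤n
    nonempty (there _) = ℕ.s≤s ℕ.z≤n

  deg≤1⇒adj-unique : ∀ {u y z} → deg A u ℕ.≤ 1 → Adj A u y → Adj A u z → y ≡ z
  deg≤1⇒adj-unique {u} deg≤1 u~y u~z =
    unique (subst (ℕ._≤ 1) (sym (length-neighbours u)) deg≤1) (adj⇒∈neighbours u~y) (adj⇒∈neighbours u~z)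
    where
    unique : ∀ {xs : List (Fin n)} {y z} → length xs ℕ.≤ 1 → y ∈ₗ xs → z ∈ₗ xs → y ≡ z
    unique {_ ∷ []}    _           (here refl) (here refl) = refl
    unique {_ ∷ _ ∷ _} (ℕ.s≤s ()) _           _

  adj-sym : ∀ {u v} → Adj A u v → Adj A v u
  adj-sym (inj₁ u→v) = inj₂ u→v
  adj-sym (inj₂ v→u) = inj₁ v→u

  module _ {P : Fin n → Set} where

    Walk-head : ∀ {u v l} → Walk A P u v l → P u
    Walk-head (here pu)     = pu
    Walk-head (step pu _ _) = pu

    Walk-last : ∀ {u v l} → Walk A P u v l → P v
    Walk-last (here pv)     = pv
    Walk-last (step _ _ w) = Walk-last w

    Walk-weaken : ∀ {Q : Fin n → Set} → (∀ {x} → P x → Q x) → ∀ {u v l} → Walk A P u v l → Walk A Q u v l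
    Walk-weaken P⇒Q (here pu)       = here (P⇒Q pu)
    Walk-weaken P⇒Q (step pu u~v w) = step (P⇒Q pu) u~v (Walk-weaken P⇒Q w)

    _++ʷ_ : ∀ {u v w l m} → Walk A P u v l → Walk A P v w m → Walk A P u w (l ℕ.+ m)
    here _        ++ʷ w′ = w′
    step pu u~v w ++ʷ w′ = step pu u~v (w ++ʷ w′)

    Walk-reverse : ∀ {u v l} → Walk A P u v l → Walk A P v u l
    Walk-reverse (here pu) = here pu
    Walk-reverse {l = suc l} (step pu u~v w) =
      subst (Walk A P _ _) (ℕ.+-comm l 1) (Walk-reverse w ++ʷ step (Walk-head w) (adj-sym u~v) (here pu))

  Walk-trapped : (∀ u → deg A u ℕ.≤ 1) → ∀ {a b} → Adj A a b →
    ∀ {P u z l} → Walk A P u z l → u ≡ a ⊎ u ≡ b → z ≡ a ⊎ z ≡ b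
  Walk-trapped deg≤1 a~b (here _)         u∈ab        = u∈ab
  Walk-trapped deg≤1 a~b (step _ a~y w)   (inj₁ refl) =
    Walk-trapped deg≤1 a~b w (inj₂ (deg≤1⇒adj-unique (deg≤1 _) a~y a~b))
  Walk-trapped deg≤1 a~b (step _ b~y w)   (inj₂ refl) =
    Walk-trapped deg≤1 a~b w (inj₁ (deg≤1⇒adj-unique (deg≤1 _) b~y (adj-sym a~b)))

  adj? : ∀ u v → Dec (Adj A u v)
  adj? u v = (u , v) ∈?ₗ A ⊎-dec (v , u) ∈?ₗ A
    where open import Data.List.Membership.DecPropositional (≡-dec _≟_ _≟_) using () renaming (_∈?_ to _∈?ₗ_)

  walk? : ∀ l u v → Dec (Walk A (AllV A) u v l)
  walk? zero    u v with u ≟ v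
  ... | yes refl = yes (here tt)
  ... | no u≢v   = no λ { (here _) → u≢v refl }
  walk? (suc l) u v = map′ (λ (y , u~y , w) → step tt u~y w) (λ { (step _ u~y w) → _ , u~y , w })
    (any? λ y → adj? u y ×-dec walk? l y v)

  shortest : ∀ {u v l} → Walk A (AllV A) u v l → ∃[ d ] Dist A (AllV A) u v d
  shortest {u} {v} w with minimal (λ l → walk? l u v) w
  ... | d , w′ , min = d , w′ , λ _ → min

  ball : ℕ → Fin n → List (Fin n)
  ball zero    u = u ∷ []
  ball (suc m) u = u ∷ concatMap (ball m) (neighbours u)

  ∈-ball : ∀ {P u v l} m → Walk A P u v l → l ℕ.≤ m → v ∈ₗ ball m u
  ∈-ball zero    (here _)         _           = here refl
  ∈-ball (suc m) (here _)         _           = here refl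
  ∈-ball (suc m) (step _ u~y w) (ℕ.s≤s l≤m) =
    there (∈-concat⁺′ (∈-ball m w l≤m) (∈-map⁺ (ball m) (adj⇒∈neighbours u~y)))

  length-ball : ∀ {D} → (∀ u → deg A u ℕ.≤ D) → ∀ m u → length (ball m u) ℕ.≤ geomSum D m
  length-ball deg≤D zero    u = ℕ.≤-refl
  length-ball {D} deg≤D (suc m) u = ℕ.s≤s (begin
    length (concatMap (ball m) (neighbours u)) ≤⟨ length-concatMap-≤ (ball m) (length-ball deg≤D m) (neighbours u) ⟩
    length (neighbours u) ℕ.* geomSum D m      ≤⟨ ℕ.*-monoˡ-≤ (geomSum D m) neighbours≤D ⟩
    D ℕ.* geomSum D m                          ∎)
    where
    open ℕ.≤-Reasoning
    neighbours≤D : length (neighbours u) ℕ.≤ D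
    neighbours≤D = subst (ℕ._≤ D) (sym (length-neighbours u)) (deg≤D u)

  module _ (W : Subset n) where

    record LastVisit (a b : Fin n) (l : ℕ) : Set where
      constructor lastVisit
      field
        w x    : Fin n
        l₁ m   : ℕ
        w∈W    : w ∈ W
        w~x    : Adj A w x
        prefix : Walk A (AllV A) a x l₁
        suffix : Walk A (_∉ W) x b m
        length≡ : l₁ ℕ.+ m ≡ l

    avoids⊎lastVisit : ∀ {a b l} → Walk A (AllV A) a b l → b ∉ W →
      Walk A (_∉ W) a b l ⊎ LastVisit a b l
    avoids⊎lastVisit (here _) b∉W = inj₁ (here b∉W)
    avoids⊎lastVisit {a} (step _ a~y w) b∉W with avoids⊎lastVisit w b∉W
    ... | inj₂ (lastVisit w x l₁ m w∈W w~x prefix suffix l₁+m≡l) =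
      inj₂ (lastVisit w x (suc l₁) m w∈W w~x (step tt a~y prefix) suffix (cong suc l₁+m≡l))
    ... | inj₁ w∉W with a ∈? W
    ...   | yes a∈W = inj₂ (lastVisit a _ 1 _ a∈W a~y (step tt a~y (here tt)) w∉W refl)
    ...   | no a∉W  = inj₁ (step a∉W a~y w∉W)

    nearW : ℕ → List (Fin n)
    nearW j = concatMap (ball j) (elements W)

    length-nearW : ∀ {D} → (∀ u → deg A u ℕ.≤ D) → ∀ j → length (nearW j) ℕ.≤ ∣ W ∣ ℕ.* geomSum D j
    length-nearW deg≤D j = subst (λ s → length (nearW j) ℕ.≤ s ℕ.* _) (length-elements W)
      (length-concatMap-≤ (ball j) (length-ball deg≤D j) (elements W))

    module _ (connected : Connected A) {r : Fin n} (r∈W : r ∈ W) where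

      InL⇒nearW : ∀ {j v} → InL A W r j v → ∃[ w ] (w ∈ W × ∃[ l ] (Walk A (AllV A) w v l × l ℕ.≤ j))
      InL⇒nearW {j} {v} (_ , ρ , ((v~ρ , ρ-closest) , d , d<j , ρ⇝v , _))
        with shortest (proj₂ (connected r ρ))
      ... | dρ , r⇝ρ , r⇝ρ-min with avoids⊎lastVisit r⇝ρ (Walk-last (proj₂ v~ρ))
      ... | inj₁ avoiding = ⊥-elim (Walk-head avoiding r∈W)
      ... | inj₂ (lastVisit w x l₁ m w∈W w~x r⇝x x⇝ρ l₁+m≡dρ) =
        w , w∈W , suc (m ℕ.+ d) , step tt w~x (everywhere x⇝ρ ++ʷ everywhere ρ⇝v) ,
        ℕ.≤-trans (ℕ.s≤s (ℕ.+-monoˡ-≤ d m≤0)) d<j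
        where
        everywhere : ∀ {Q u v l} → Walk A Q u v l → Walk A (AllV A) u v l
        everywhere = Walk-weaken (λ _ → tt)

        x∈comp : SameComp A W v x
        x∈comp = _ , proj₂ v~ρ ++ʷ Walk-reverse x⇝ρ

        dρ≤l₁ : dρ ℕ.≤ l₁
        dρ≤l₁ with shortest r⇝x
        ... | dx , r⇝x′ , r⇝x′-min =
          ℕ.≤-trans (ρ-closest x x∈comp dρ dx (r⇝ρ , r⇝ρ-min) (r⇝x′ , r⇝x′-min)) (r⇝x′-min l₁ r⇝x)

        m≤0 : m ℕ.≤ 0
        m≤0 = ℕ.+-cancelˡ-≤ l₁ m 0 (subst₂ ℕ._≤_ (sym l₁+m≡dρ) (sym (ℕ.+-identityʳ l₁)) dρ≤l₁)

      InL⇒∈nearW : ∀ {j v} → InL A W r j v → v ∈ₗ nearW j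
      InL⇒∈nearW {j} inL with InL⇒nearW inL
      ... | w , w∈W , l , w⇝v , l≤j = ∈-concat⁺′ (∈-ball j w⇝v l≤j) (∈-map⁺ (ball j) (∈-elements w∈W))

  Vin⊎Vout : IsAntidirected A → ∀ v → v ∈ Vin A ⊎ v ∈ Vout A
  Vin⊎Vout antidirected v
    with null (filter (λ e → proj₁ e ≟ v) A) in no-out | null (filter (λ e → proj₂ e ≟ v) A) in no-in
  ... | true  | _     = inj₁ (lookup⇒[]= v (Vin A) (trans (lookup∘tabulate _ v) no-out))
  ... | false | true  = inj₂ (lookup⇒[]= v (Vout A) (trans (lookup∘tabulate _ v) no-in))
  ... | false | false with ∃-filter (λ e → proj₁ e ≟ v) no-out | ∃-filter (λ e → proj₂ e ≟ v) no-in
  ...   | (_ , b) , v→b , refl | (c , _) , c→v , refl = ⊥-elim (antidirected c v b c→v v→b)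

  n≤∣Vin∣+∣Vout∣ : IsAntidirected A → n ℕ.≤ ∣ Vin A ∣ ℕ.+ ∣ Vout A ∣
  n≤∣Vin∣+∣Vout∣ antidirected = begin
    n                         ≡⟨ ∣⊤∣≡n n ⟨
    ∣ ⊤ {n} ∣                 ≤⟨ p⊆q⇒∣p∣≤∣q∣ {p = ⊤} (λ {v} _ → x∈p∪q⁺ (Vin⊎Vout antidirected v)) ⟩
    ∣ Vin A ∪ Vout A ∣         ≤⟨ ∣p∪q∣≤∣p∣+∣q∣ (Vin A) (Vout A) ⟩
    ∣ Vin A ∣ ℕ.+ ∣ Vout A ∣  ∎
    where open ℕ.≤-Reasoning

connected⇒1≤deg : ∀ {n} {A : Arcs (suc (suc n))} → Connected A → 1 ℕ.≤ deg A Fin.zero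
connected⇒1≤deg {A = A} connected with connected Fin.zero (Fin.suc Fin.zero)
... | _ , step _ 0~b _ = adj⇒1≤deg A 0~b

¬deg≤1 : ∀ {n} {A : Arcs (suc (suc (suc n)))} → Connected A → ¬ (∀ u → deg A u ℕ.≤ 1)
¬deg≤1 {A = A} connected deg≤1 with connected Fin.zero (Fin.suc Fin.zero)
... | _ , step _ 0~b b⇝1
  with Walk-trapped A deg≤1 0~b b⇝1 (inj₂ refl)
     | Walk-trapped A deg≤1 0~b (proj₂ (connected Fin.zero (Fin.suc (Fin.suc Fin.zero)))) (inj₁ refl)
... | inj₂ refl | inj₁ ()
... | inj₂ refl | inj₂ ()

module _ {n : ℕ} (A : Arcs (suc n)) where

  maxDegreeVertex : Fin (suc n)
  maxDegreeVertex = argmax (deg A) Fin.zero (allFin _)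

  deg≤maxDegree : ∀ u → deg A u ℕ.≤ deg A maxDegreeVertex
  deg≤maxDegree u = All.lookup (f[xs]≤f[argmax] {f = deg A} Fin.zero (allFin _)) (∈-allFin u)

2≤maxDegree : ∀ {n} {A : Arcs (suc (suc (suc n)))} → Connected A → 2 ℕ.≤ deg A (maxDegreeVertex A)
2≤maxDegree {A = A} connected =
  ℕ.≮⇒≥ (λ Δ<2 → ¬deg≤1 connected (λ u → ℕ.≤-trans (deg≤maxDegree A u) (ℕ.≤-pred Δ<2)))


-- ⟦ n ⟧ unfolds to fromℚᵘ (mkℚᵘ (+ n) 0).
⟦⟧-toℚᵘ : ∀ n → toℚᵘ ⟦ n ⟧ ℚᵘ.≃ ℚᵘ.mkℚᵘ (+ n) 0
⟦⟧-toℚᵘ n = toℚᵘ-fromℚᵘ (ℚᵘ.mkℚᵘ (+ n) 0)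

⟦⟧-+ : ∀ m n → ⟦ m ℕ.+ n ⟧ ≡ ⟦ m ⟧ + ⟦ n ⟧
⟦⟧-+ m n = toℚᵘ-injective (begin-equality
  toℚᵘ ⟦ m ℕ.+ n ⟧                      ≃⟨ ⟦⟧-toℚᵘ (m ℕ.+ n) ⟩
  ℚᵘ.mkℚᵘ (+ (m ℕ.+ n)) 0               ≃⟨ ℚᵘ.*≡* (cong (ℤ._* + 1) (sym (cong₂ ℤ._+_ (m*1≡m m) (m*1≡m n)))) ⟩
  ℚᵘ.mkℚᵘ (+ m) 0 ℚᵘ.+ ℚᵘ.mkℚᵘ (+ n) 0  ≃⟨ ℚᵘ.+-cong (⟦⟧-toℚᵘ m) (⟦⟧-toℚᵘ n) ⟨
  toℚᵘ ⟦ m ⟧ ℚᵘ.+ toℚᵘ ⟦ n ⟧            ≃⟨ toℚᵘ-homo-+ ⟦ m ⟧ ⟦ n ⟧ ⟨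
  toℚᵘ (⟦ m ⟧ + ⟦ n ⟧)                  ∎)
  where
  open ℚᵘ.≤-Reasoning
  m*1≡m : ∀ m → + m ℤ.* + 1 ≡ + m
  m*1≡m m = ℤ.*-identityʳ (+ m)

⟦⟧-* : ∀ m n → ⟦ m ℕ.* n ⟧ ≡ ⟦ m ⟧ * ⟦ n ⟧
⟦⟧-* m n = toℚᵘ-injective (begin-equality
  toℚᵘ ⟦ m ℕ.* n ⟧                      ≃⟨ ⟦⟧-toℚᵘ (m ℕ.* n) ⟩
  ℚᵘ.mkℚᵘ (+ (m ℕ.* n)) 0               ≃⟨ ℚᵘ.*≡* (cong (ℤ._* + 1) (ℤ.pos-* m n)) ⟩
  ℚᵘ.mkℚᵘ (+ m) 0 ℚᵘ.* ℚᵘ.mkℚᵘ (+ n) 0  ≃⟨ ℚᵘ.*-cong (⟦⟧-toℚᵘ m) (⟦⟧-toℚᵘ n) ⟨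
  toℚᵘ ⟦ m ⟧ ℚᵘ.* toℚᵘ ⟦ n ⟧            ≃⟨ toℚᵘ-homo-* ⟦ m ⟧ ⟦ n ⟧ ⟨
  toℚᵘ (⟦ m ⟧ * ⟦ n ⟧)                  ∎)
  where open ℚᵘ.≤-Reasoning

⟦⟧-nonNeg : ∀ n → NonNegative ⟦ n ⟧
⟦⟧-nonNeg n = normalize-nonNeg n 1

⟦⟧-mono-≤ : ∀ {m n} → m ℕ.≤ n → ⟦ m ⟧ ≤ ⟦ n ⟧
⟦⟧-mono-≤ {m} {n} m≤n = begin
  ⟦ m ⟧                     ≡⟨ +-identityʳ ⟦ m ⟧ ⟨
  ⟦ m ⟧ + 0ℚ                ≤⟨ +-monoʳ-≤ ⟦ m ⟧ (nonNegative⁻¹ ⟦ n ℕ.∸ m ⟧ {{⟦⟧-nonNeg (n ℕ.∸ m)}}) ⟩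
  ⟦ m ⟧ + ⟦ n ℕ.∸ m ⟧       ≡⟨ ⟦⟧-+ m (n ℕ.∸ m) ⟨
  ⟦ m ℕ.+ (n ℕ.∸ m) ⟧       ≡⟨ cong ⟦_⟧ (ℕ.m+[n∸m]≡n m≤n) ⟩
  ⟦ n ⟧                     ∎
  where open ≤-Reasoning

+-cancelʳ-≤ : ∀ {p q} r → p + r ≤ q + r → p ≤ q
+-cancelʳ-≤ {p} {q} r p+r≤q+r = subst₂ _≤_ (p+r-r≡p p) (p+r-r≡p q) (+-monoˡ-≤ (- r) p+r≤q+r)
  where
  p+r-r≡p : ∀ p → p + r - r ≡ p
  p+r-r≡p p = solve 2 (λ p r → p :+ r :- r := p) refl p r

error≤αK : ∀ {α β K W E M} .{{_ : NonNegative α}} .{{_ : NonNegative K}} .{{_ : NonNegative W}} →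
  β ≤ ½ → M ≤ W * E → E * ⟦ 8 ⟧ ≤ α * β * K → W * β ≤ 1ℚ + ⟦ 2 ⟧ * β → M * ⟦ 4 ⟧ ≤ α * K
error≤αK {α} {β} {K} {W} {E} {M} β≤½ M≤WE 8E≤αβK Wβ≤1+2β = *-cancelʳ-≤-pos ⟦ 2 ⟧ (begin
  M * ⟦ 4 ⟧ * ⟦ 2 ⟧  ≡⟨ *-assoc M ⟦ 4 ⟧ ⟦ 2 ⟧ ⟩
  M * ⟦ 8 ⟧          ≤⟨ *-monoʳ-≤-nonNeg ⟦ 8 ⟧ M≤WE ⟩
  W * E * ⟦ 8 ⟧      ≡⟨ *-assoc W E ⟦ 8 ⟧ ⟩
  W * (E * ⟦ 8 ⟧)    ≤⟨ *-monoˡ-≤-nonNeg W 8E≤αβK ⟩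
  W * (α * β * K)    ≡⟨ solve 4 (λ W α β K → W :* (α :* β :* K) := W :* β :* (α :* K)) refl W α β K ⟩
  W * β * (α * K)    ≤⟨ *-monoʳ-≤-nonNeg (α * K) (≤-trans Wβ≤1+2β 1+2β≤2) ⟩
  ⟦ 2 ⟧ * (α * K)    ≡⟨ *-comm ⟦ 2 ⟧ (α * K) ⟩
  α * K * ⟦ 2 ⟧      ∎)
  where
  open ≤-Reasoning
  instance
    αK≥0 : NonNegative (α * K)
    αK≥0 = nonNeg*nonNeg⇒nonNeg α K
  1+2β≤2 : 1ℚ + ⟦ 2 ⟧ * β ≤ ⟦ 2 ⟧
  1+2β≤2 = +-monoʳ-≤ 1ℚ (*-monoˡ-≤-nonNeg ⟦ 2 ⟧ β≤½)

error≤αP : ∀ {α P K M} .{{_ : NonNegative α}} .{{_ : NonNegative P}} .{{_ : NonNegative M}} →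
  α ≤ ½ → M * ⟦ 4 ⟧ ≤ α * K → K ≤ (P + M) + (P + M) → M ≤ α * P
error≤αP {α} {P} {K} {M} α≤½ 4M≤αK K≤2[P+M] = *-cancelʳ-≤-pos ⟦ 3 ⟧ (begin
  M * ⟦ 3 ⟧          ≤⟨ +-cancelʳ-≤ M 3M+M≤2αP+M ⟩
  α * P * ⟦ 2 ⟧      ≤⟨ *-monoˡ-≤-nonNeg (α * P) (⟦⟧-mono-≤ {2} {3} (ℕ.n≤1+n 2)) ⟩
  α * P * ⟦ 3 ⟧      ∎)
  where
  open ≤-Reasoning
  instance
    αP≥0 : NonNegative (α * P)
    αP≥0 = nonNeg*nonNeg⇒nonNeg α P
  2αM≤M : α * ⟦ 2 ⟧ * M ≤ M
  2αM≤M = begin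
    α * ⟦ 2 ⟧ * M  ≤⟨ *-monoʳ-≤-nonNeg M (*-monoʳ-≤-nonNeg ⟦ 2 ⟧ α≤½) ⟩
    1ℚ * M         ≡⟨ *-identityˡ M ⟩
    M              ∎
  3M+M≤2αP+M : M * ⟦ 3 ⟧ + M ≤ α * P * ⟦ 2 ⟧ + M
  3M+M≤2αP+M = begin
    M * ⟦ 3 ⟧ + M                ≡⟨ solve 1 (λ M → M :* con ⟦ 3 ⟧ :+ M := M :* con ⟦ 4 ⟧) refl M ⟩
    M * ⟦ 4 ⟧                    ≤⟨ 4M≤αK ⟩
    α * K                        ≤⟨ *-monoˡ-≤-nonNeg α K≤2[P+M] ⟩
    α * ((P + M) + (P + M))      ≡⟨ solve 3 (λ α P M → α :* ((P :+ M) :+ (P :+ M))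
                                                  := α :* P :* con ⟦ 2 ⟧ :+ α :* con ⟦ 2 ⟧ :* M) refl α P M ⟩
    α * P * ⟦ 2 ⟧ + α * ⟦ 2 ⟧ * M ≤⟨ +-monoʳ-≤ (α * P * ⟦ 2 ⟧) 2αM≤M ⟩
    α * P * ⟦ 2 ⟧ + M            ∎

ratio-bounds : ∀ {α P Q M} → Q ≤ P + M → P ≤ Q + M → M ≤ α * P →
  ((1ℚ - α) * P ≤ Q) × (Q ≤ (1ℚ + α) * P)
ratio-bounds {α} {P} {Q} {M} Q≤P+M P≤Q+M M≤αP = lower , upper
  where
  open ≤-Reasoning
  lower = +-cancelʳ-≤ M (begin
    (1ℚ - α) * P + M      ≤⟨ +-monoʳ-≤ ((1ℚ - α) * P) M≤αP ⟩
    (1ℚ - α) * P + α * P  ≡⟨ solve 2 (λ α P → (con 1ℚ :- α) :* P :+ α :* P := P) refl α P ⟩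
    P                     ≤⟨ P≤Q+M ⟩
    Q + M                 ∎)
  upper = begin
    Q                     ≤⟨ Q≤P+M ⟩
    P + M                 ≤⟨ +-monoʳ-≤ P M≤αP ⟩
    P + α * P             ≡⟨ solve 2 (λ α P → P :+ α :* P := (con 1ℚ :+ α) :* P) refl α P ⟩
    (1ℚ + α) * P          ∎

αβ<8E : ∀ {α β} .{{_ : NonNegative α}} .{{_ : NonNegative β}} → α ≤ ½ → β ≤ ½ →
  ∀ {E} → 1 ℕ.≤ E → α * β * ⟦ 1 ⟧ < ⟦ E ⟧ * ⟦ 8 ⟧
αβ<8E {α} {β} α≤½ β≤½ {E} 1≤E = begin-strict
  α * β * ⟦ 1 ⟧  ≤⟨ *-monoʳ-≤-nonNeg ⟦ 1 ⟧ (≤-trans (*-monoʳ-≤-nonNeg β α≤½) (*-monoˡ-≤-nonNeg ½ β≤½)) ⟩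
  ½ * ½ * ⟦ 1 ⟧  <⟨ toWitness {a? = ½ * ½ * ⟦ 1 ⟧ <? ⟦ 8 ⟧} tt ⟩
  ⟦ 8 ⟧          ≡⟨ *-identityˡ ⟦ 8 ⟧ ⟨
  ⟦ 1 ⟧ * ⟦ 8 ⟧  ≤⟨ *-monoʳ-≤-nonNeg ⟦ 8 ⟧ (⟦⟧-mono-≤ 1≤E) ⟩
  ⟦ E ⟧ * ⟦ 8 ⟧  ∎
  where open ≤-Reasoning

balanced-ratio : ∀ {α β} .{{_ : NonNegative α}} → α ≤ ½ → β ≤ ½ →
  ∀ {k p q M w E} → q ℕ.≤ p ℕ.+ M → p ℕ.≤ q ℕ.+ M → suc k ℕ.≤ (p ℕ.+ M) ℕ.+ (p ℕ.+ M) → M ℕ.≤ w ℕ.* E →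
  ⟦ E ⟧ * ⟦ 8 ⟧ ≤ α * β * ⟦ suc k ⟧ → ⟦ w ⟧ * β ≤ 1ℚ + ⟦ 2 ⟧ * β →
  ((1ℚ - α) * ⟦ p ⟧ ≤ ⟦ q ⟧) × (⟦ q ⟧ ≤ (1ℚ + α) * ⟦ p ⟧)
balanced-ratio {α} {β} α≤½ β≤½ {k} {p} {q} {M} {w} {E} q≤p+M p≤q+M n≤2[p+M] M≤wE 8E≤αβK wβ≤1+2β =
  ratio-bounds {α} {⟦ p ⟧} {⟦ q ⟧} {⟦ M ⟧} (⟦⟧-mono-≤-+ p M q≤p+M) (⟦⟧-mono-≤-+ q M p≤q+M)
    (error≤αP {α} {⟦ p ⟧} {⟦ suc k ⟧} {⟦ M ⟧} α≤½ 4M≤αK K≤2[P+M])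
  where
  instance
    K≥0 = ⟦⟧-nonNeg (suc k)
    P≥0 = ⟦⟧-nonNeg p
    M≥0 = ⟦⟧-nonNeg M
    w≥0 = ⟦⟧-nonNeg w
  ⟦⟧-mono-≤-+ : ∀ {a} b c → a ℕ.≤ b ℕ.+ c → ⟦ a ⟧ ≤ ⟦ b ⟧ + ⟦ c ⟧
  ⟦⟧-mono-≤-+ {a} b c = subst (⟦ a ⟧ ≤_) (⟦⟧-+ b c) ∘′ ⟦⟧-mono-≤
  4M≤αK : ⟦ M ⟧ * ⟦ 4 ⟧ ≤ α * ⟦ suc k ⟧
  4M≤αK = error≤αK {α} {β} {⟦ suc k ⟧} {⟦ w ⟧} {⟦ E ⟧} {⟦ M ⟧} β≤½
    (subst (⟦ M ⟧ ≤_) (⟦⟧-* w E) (⟦⟧-mono-≤ M≤wE)) 8E≤αβK wβ≤1+2β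
  K≤2[P+M] : ⟦ suc k ⟧ ≤ (⟦ p ⟧ + ⟦ M ⟧) + (⟦ p ⟧ + ⟦ M ⟧)
  K≤2[P+M] = subst (⟦ suc k ⟧ ≤_) (trans (⟦⟧-+ (p ℕ.+ M) (p ℕ.+ M)) (cong₂ _+_ (⟦⟧-+ p M) (⟦⟧-+ p M)))
    (⟦⟧-mono-≤ n≤2[p+M])

lemma2 : (k j : ℕ) (α β : ℚ) →
    0ℚ < α → α < ½ → 0ℚ < β → β < ½ →
    (A : Arcs (suc (suc k))) → (r : Fin (suc (suc k))) →
    IsTree A → IsAntidirected A → IsBalanced A →
    (∀ v → ⟦ deg A v ^ (suc (suc j)) ⟧ * ⟦ 8 ⟧ ≤ α * β * ⟦ suc k ⟧) →
    (W : Subset (suc (suc k))) → IsDecomposition A W (suc k) r β →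
    (PT QT : Subset (suc (suc k))) →
    (∀ v → (v ∈ PT) ⇔ (v ∈ Vin A × ¬ InL A W r (suc j) v)) →
    (∀ v → (v ∈ QT) ⇔ (v ∈ Vout A × ¬ InL A W r (suc j) v)) →
    ((1ℚ - α) * ⟦ ∣ PT ∣ ⟧ ≤ ⟦ ∣ QT ∣ ⟧) × (⟦ ∣ QT ∣ ⟧ ≤ (1ℚ + α) * ⟦ ∣ PT ∣ ⟧)
-- On two vertices Δ = 1 and the degree bound would read 8 ≤ αβ.
lemma2 zero j α β 0<α α<½ 0<β β<½ A r (connected , _) _ _ deg-bound _ _ _ _ _ _ =
  ⊥-elim (<-irrefl refl (≤-<-trans (deg-bound Fin.zero) (αβ<8E (<⇒≤ α<½) (<⇒≤ β<½) 1≤E)))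
  where
  instance
    α≥0 = nonNegative (<⇒≤ 0<α)
    β≥0 = nonNegative (<⇒≤ 0<β)
  1≤E : 1 ℕ.≤ deg A Fin.zero ^ suc (suc j)
  1≤E = ℕ.m^n>0 (deg A Fin.zero) {{ℕ.>-nonZero (connected⇒1≤deg connected)}} (suc (suc j))
lemma2 (suc k) j α β 0<α α<½ 0<β β<½ A r (connected , _) antidirected balanced deg-bound
       W (r∈W , _ , W-bound) PT QT PT≡Vin∖L QT≡Vout∖L =
  balanced-ratio (<⇒≤ α<½) (<⇒≤ β<½) {p = ∣ PT ∣} {∣ QT ∣} {M} {∣ W ∣} {Δ ^ suc (suc j)}
    q≤p+M p≤q+M n≤2[p+M] M≤wE (deg-bound (maxDegreeVertex A)) W-bound
  where
  instance α≥0 = nonNegative (<⇒≤ 0<α)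
  Δ = deg A (maxDegreeVertex A)
  M = length (nearW A W (suc j))

  Vin≤p+M : ∣ Vin A ∣ ℕ.≤ ∣ PT ∣ ℕ.+ M
  Vin≤p+M = ∣p∣≤∣p∖X∣+length _ (InL⇒∈nearW A W connected r∈W) PT≡Vin∖L
  Vout≤p+M : ∣ Vout A ∣ ℕ.≤ ∣ PT ∣ ℕ.+ M
  Vout≤p+M = subst (ℕ._≤ ∣ PT ∣ ℕ.+ M) balanced Vin≤p+M
  Vout≤q+M : ∣ Vout A ∣ ℕ.≤ ∣ QT ∣ ℕ.+ M
  Vout≤q+M = ∣p∣≤∣p∖X∣+length _ (InL⇒∈nearW A W connected r∈W) QT≡Vout∖L

  q≤p+M : ∣ QT ∣ ℕ.≤ ∣ PT ∣ ℕ.+ M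
  q≤p+M = ℕ.≤-trans (p⊆q⇒∣p∣≤∣q∣ (proj₁ ∘′ Equivalence.to (QT≡Vout∖L _))) Vout≤p+M
  p≤q+M : ∣ PT ∣ ℕ.≤ ∣ QT ∣ ℕ.+ M
  p≤q+M = ℕ.≤-trans (p⊆q⇒∣p∣≤∣q∣ (proj₁ ∘′ Equivalence.to (PT≡Vin∖L _)))
                    (subst (ℕ._≤ ∣ QT ∣ ℕ.+ M) (sym balanced) Vout≤q+M)
  n≤2[p+M] : suc (suc k) ℕ.≤ (∣ PT ∣ ℕ.+ M) ℕ.+ (∣ PT ∣ ℕ.+ M)
  n≤2[p+M] = ℕ.≤-trans (ℕ.n≤1+n _) (ℕ.≤-trans (n≤∣Vin∣+∣Vout∣ A antidirected) (ℕ.+-mono-≤ Vin≤p+M Vout≤p+M))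
  M≤wE : M ℕ.≤ ∣ W ∣ ℕ.* Δ ^ suc (suc j)
  M≤wE = ℕ.≤-trans (length-nearW A W (deg≤maxDegree A) (suc j))
                   (ℕ.*-monoʳ-≤ ∣ W ∣ (ℕ.<⇒≤ (geomSum<^ (2≤maxDegree connected) (suc j))))
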